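{- For every $n\ge1$, \[\sum_{\sigma\in B_n} q^{\text{flag-major}_F(\sigma^{ -1})}\,t^{\text{flag-major}_F(\sigma)}=\sum_{\sigma\in B_n} q^{finv_F(\sigma)}\,t^{\text{flag-major}_F(\sigma)}.\]
   Context: $B_n$ is the group of bijections $\sigma$ of $[-n,n]\setminus\{0\}$ with $\sigma(-a)=-\sigma(a)$, written $\sigma=[\sigma(1),\dots,\sigma(n)]$. $F$ is the friends order $1<-1<2<-2<\dots<n<-n$. $Des_F(\sigma)=\{1\le i\le n-1:\sigma(i)>_F\sigma(i+1)\}$, $maj_F(\sigma)=\sum_{i\in Des_F(\sigma)}i$, $inv_F(\sigma)=|\{i<j:\sigma(i)>_F\sigma(j)\}|$, $neg(\sigma)=|\{i:\sigma(i)<0\}|$, $\text{flag-major}_F(\sigma)=2maj_F(\sigma)+neg(\sigma)$, $finv_F(\sigma)=2inv_F(\sigma)+neg(\sigma)$. -}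

module Defs where

open import Data.Nat using (ℕ; zero; suc; _+_; _*_; _∸_; _<ᵇ_; _≡ᵇ_)
open import Data.Integer using (ℤ; +_; -[1+_]; ∣_∣)
open import Data.Bool using (Bool; true; false; if_then_else_; _∧_)
open import Data.List using (List; []; _∷_; _++_; map; concatMap; length; filterᵇ; upTo)
open import Data.List.Relation.Unary.Unique.Propositional using (Unique)

-- A signed permutation σ ∈ B_n is represented by its window
-- [σ(1), …, σ(n)] : List ℤ.

signedValues : ℕ → List ℤ
signedValues n = map (λ i → -[1+ i ]) (upTo n) ++ map (λ i → + suc i) (upTo n)

words : {A : Set} → ℕ → List A → List (List A)
words zero    L = [] ∷ []
words (suc k) L = concatMap (λ x → map (x ∷_) (words k L)) L

noRepeat : List ℕ → Bool
noRepeat [] = true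
noRepeat (x ∷ xs) = notIn x xs ∧ noRepeat xs
  where
  notIn : ℕ → List ℕ → Bool
  notIn x [] = true
  notIn x (y ∷ ys) = if x ≡ᵇ y then false else notIn x ys

B : ℕ → List (List ℤ)
B n = filterᵇ (λ w → noRepeat (map ∣_∣ w)) (words n (signedValues n))

-- the inverse signed permutation: σ⁻¹(j) = ±i where σ(i) = ±j
invAt : ℕ → List ℤ → ℕ → ℤ
invAt i [] j = + 0
invAt i (+ m ∷ w) j = if m ≡ᵇ j then + i else invAt (suc i) w j
invAt i (-[1+ m ] ∷ w) j = if suc m ≡ᵇ j then -[1+ (i ∸ 1) ] else invAt (suc i) w j

inverse : List ℤ → List ℤ
inverse w = map (λ j → invAt 1 w (suc j)) (upTo (length w))

-- position in the friends order 1 < -1 < 2 < -2 < … < n < -n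
key : ℤ → ℕ
key (+ m) = 2 * m ∸ 1
key -[1+ m ] = 2 * suc m

_>F_ : ℤ → ℤ → Bool
a >F b = key b <ᵇ key a

majFrom : ℕ → List ℤ → ℕ
majFrom i [] = 0
majFrom i (x ∷ []) = 0
majFrom i (x ∷ y ∷ w) = (if x >F y then i else 0) + majFrom (suc i) (y ∷ w)

majF : List ℤ → ℕ
majF = majFrom 1

invF : List ℤ → ℕ
invF [] = 0
invF (x ∷ w) = length (filterᵇ (λ y → x >F y) w) + invF w

isNeg : ℤ → Bool
isNeg (+ _) = false
isNeg -[1+ _ ] = true

neg : List ℤ → ℕ
neg w = length (filterᵇ isNeg w)

flagMajF : List ℤ → ℕ
flagMajF w = 2 * majF w + neg w

finvF : List ℤ → ℕ
finvF w = 2 * invF w + neg w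

-- coefficient of q^a t^b in  Σ_{σ ∈ B_n} q^{f σ} t^{g σ}
coeff : ℕ → (List ℤ → ℕ) → (List ℤ → ℕ) → ℕ → ℕ → ℕ
coeff n f g a b = length (filterᵇ (λ σ → (f σ ≡ᵇ a) ∧ (g σ ≡ᵇ b)) (B n))

-- Substituting σ⁻¹ for σ, the left-hand side counts the pairs (fmaj_F σ, fmaj_F σ⁻¹); since
-- σ ↦ σ⁻¹ preserves inv_F and neg, the right-hand side counts the pairs (finv_F σ, fmaj_F σ⁻¹).
-- Foata's bijection φ for the total order F carries the first pair of statistics to the second.
-- It rearranges the letters of a word so that inv_F (φ w) = maj_F w, hence preserves neg, and it
-- never changes the relative order of two letters that no other letter of the word separates
-- in F.  In a window of B_n the letters of absolute values j and j + 1 form such a pair, and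
-- their relative order is the descent of σ⁻¹ at j, so φ also preserves maj_F σ⁻¹ and neg σ⁻¹.
module Submission where

open import Data.Bool using (Bool; true; false; if_then_else_; _∧_; _∨_; not; T)
open import Data.Bool.Properties using (T?; not-¬; T-∧; ∧-comm)
open import Data.Empty using (⊥; ⊥-elim)
open import Data.Integer using (ℤ; +_; -[1+_]; ∣_∣; sign; _◃_)
import Data.Integer as ℤ
open import Data.Integer.Properties using (abs-◃; sign-◃; ◃-inverse)
open import Data.List
  using (List; []; _∷_; _++_; _∷ʳ_; map; length; filterᵇ; applyUpTo; upTo; reverse; concatMap)
import Data.List.Properties as List
open import Data.List.Membership.Propositional using (_∈_; _∉_; find; lose)
open import Data.List.Membership.Propositional.Properties
open import Data.List.Membership.Propositional.Properties.WithK using (unique∧set⇒bag)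
open import Data.List.Relation.Binary.BagAndSetEquality using (∼bag⇒↭)
open import Data.List.Relation.Binary.Permutation.Propositional
  using (_↭_; ↭-refl; ↭-sym; ↭-trans; prep; swap; ↭⇒↭ₛ)
open import Data.List.Relation.Binary.Permutation.Propositional.Properties
  using (↭-length; filter-↭; map⁺; ∷↭∷ʳ; ++⁺ʳ; ↭-reverse; ↭-empty-inv; All-resp-↭; ∈-resp-↭)
import Data.List.Relation.Binary.Permutation.Setoid.Properties as Permutationₛ
open import Data.List.Relation.Binary.Subset.Propositional using (_⊆_)
open import Data.List.Relation.Unary.All as All using (All; []; _∷_)
import Data.List.Relation.Unary.All.Properties as All
open import Data.List.Relation.Unary.AllPairs using ([]; _∷_)
open import Data.List.Relation.Unary.Any using (here; there)
open import Data.List.Relation.Unary.Unique.Propositional using (Unique)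
import Data.List.Relation.Unary.Unique.Propositional.Properties as Unique
open import Data.Nat using (ℕ; zero; suc; pred; _+_; _*_; _∸_; _≤_; _<_; _<ᵇ_; _≡ᵇ_; z≤n; s≤s; s≤s⁻¹)
import Data.Nat.Properties as ℕ
open import Algebra.Properties.CommutativeSemigroup ℕ.+-commutativeSemigroup using (interchange; x∙yz≈y∙xz)
open import Data.Nat.ListAction using (sum)
open import Data.Nat.ListAction.Properties using (sum-↭)
open import Data.Product using (_×_; _,_; proj₁; proj₂; ∃₂; uncurry)
open import Data.Sum using (_⊎_; inj₁; inj₂)
open import Data.Unit using (⊤; tt)
open import Function.Base using (_∘_)
open import Function.Bundles using (mk⇔; Equivalence)
open import Relation.Binary.Definitions using (DecidableEquality; tri<; tri≈; tri>)
open import Relation.Binary.PropositionalEquality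
open import Relation.Nullary using (¬_; yes; no)
open import Relation.Nullary.Decidable using (dec-true; dec-false)

open import Defs

⟦_⟧ : Bool → ℕ
⟦ true  ⟧ = 1
⟦ false ⟧ = 0

<ᵇ≡true⇒< : ∀ {m n} → (m <ᵇ n) ≡ true → m < n
<ᵇ≡true⇒< {m} {n} e = ℕ.<ᵇ⇒< m n (subst T (sym e) tt)

<ᵇ≡false⇒≮ : ∀ {m n} → (m <ᵇ n) ≡ false → ¬ m < n
<ᵇ≡false⇒≮ {m} {n} e m<n = not-¬ (dec-true (m ℕ.<? n) m<n) e

≡ᵇ≡true⇒≡ : ∀ {m n} → (m ≡ᵇ n) ≡ true → m ≡ n
≡ᵇ≡true⇒≡ {m} {n} e = ℕ.≡ᵇ⇒≡ m n (subst T (sym e) tt)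

≡ᵇ≡false⇒≢ : ∀ {m n} → (m ≡ᵇ n) ≡ false → m ≢ n
≡ᵇ≡false⇒≢ {m} {n} e m≡n = not-¬ (dec-true (m ℕ.≟ n) m≡n) e

count : {A : Set} → (A → Bool) → List A → ℕ
count p xs = length (filterᵇ p xs)

InjectiveOn : {A B : Set} → (A → B) → List A → Set
InjectiveOn f xs = ∀ {x y} → x ∈ xs → y ∈ xs → f x ≡ f y → x ≡ y

module _ {A : Set} where

  count-++ : ∀ (p : A → Bool) xs ys → count p (xs ++ ys) ≡ count p xs + count p ys
  count-++ p xs ys = trans (cong length (List.filter-++ (T? ∘ p) xs ys)) (List.length-++ (filterᵇ p xs))

  count-↭ : ∀ (p : A → Bool) {xs ys} → xs ↭ ys → count p xs ≡ count p ys
  count-↭ p xs↭ys = ↭-length (filter-↭ (T? ∘ p) xs↭ys)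

  count-cong : ∀ {p q : A → Bool} xs → (∀ {x} → x ∈ xs → p x ≡ q x) → count p xs ≡ count q xs
  count-cong [] p≗q = refl
  count-cong {p} {q} (x ∷ xs) p≗q with p x | q x | p≗q (here refl)
  ... | true  | true  | _ = cong suc (count-cong xs (p≗q ∘ there))
  ... | false | false | _ = count-cong xs (p≗q ∘ there)

  count-∷ : ∀ (p : A → Bool) x xs → count p (x ∷ xs) ≡ ⟦ p x ⟧ + count p xs
  count-∷ p x xs with p x
  ... | true  = refl
  ... | false = refl

  count-∷ʳ : ∀ (p : A → Bool) xs x → count p (xs ∷ʳ x) ≡ count p xs + ⟦ p x ⟧
  count-∷ʳ p xs x =
    trans (count-++ p xs (x ∷ [])) (cong (_+_ (count p xs)) (trans (count-∷ p x []) (ℕ.+-identityʳ _)))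

  count-+-count-not : ∀ (p : A → Bool) xs → count p xs + count (not ∘ p) xs ≡ length xs
  count-+-count-not p [] = refl
  count-+-count-not p (x ∷ xs) with p x
  ... | true  = cong suc (count-+-count-not p xs)
  ... | false = trans (ℕ.+-suc _ _) (cong suc (count-+-count-not p xs))

  count-map : ∀ {B : Set} (p : B → Bool) (f : A → B) xs → count p (map f xs) ≡ count (p ∘ f) xs
  count-map p f [] = refl
  count-map p f (x ∷ xs) with p (f x)
  ... | true  = cong suc (count-map p f xs)
  ... | false = count-map p f xs

  filterᵇ-∷-cong : ∀ (q : A → Bool) x {xs ys} → filterᵇ q xs ≡ filterᵇ q ys →
    filterᵇ q (x ∷ xs) ≡ filterᵇ q (x ∷ ys)
  filterᵇ-∷-cong q x eq with q x
  ... | true  = cong (x ∷_) eq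
  ... | false = eq

  filterᵇ-swap : ∀ (q : A → Bool) {a b} v → (q a ≡ true → q b ≡ true → ⊥) →
    filterᵇ q (a ∷ b ∷ v) ≡ filterᵇ q (b ∷ a ∷ v)
  filterᵇ-swap q {a} {b} v ¬qa∧qb with q a in qa | q b in qb
  ... | true  | true  = ⊥-elim (¬qa∧qb refl refl)
  ... | true  | false rewrite qa | qb = refl
  ... | false | true  rewrite qa | qb = refl
  ... | false | false rewrite qa | qb = refl

  unique-↭ : ∀ {xs ys : List A} → xs ↭ ys → Unique xs → Unique ys
  unique-↭ xs↭ys = Permutationₛ.Unique-resp-↭ (setoid A) (↭⇒↭ₛ xs↭ys)

  unique-map⁺-injectiveOn : ∀ {B : Set} (f : A → B) {xs} → Unique xs → InjectiveOn f xs → Unique (map f xs)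
  unique-map⁺-injectiveOn f [] _ = []
  unique-map⁺-injectiveOn f (x∉xs ∷ !xs) f-inj =
    All.map⁺ (All.tabulate λ y∈xs fx≡fy → All.lookup x∉xs y∈xs (f-inj (here refl) (there y∈xs) fx≡fy))
    ∷ unique-map⁺-injectiveOn f !xs (λ x∈ y∈ → f-inj (there x∈) (there y∈))

  unique-map⇒injectiveOn : ∀ {B : Set} (f : A → B) {xs} → Unique (map f xs) → InjectiveOn f xs
  unique-map⇒injectiveOn f _          (here refl) (here refl) _  = refl
  unique-map⇒injectiveOn f (fx∉ ∷ _)  (here refl) (there y∈)  eq =
    ⊥-elim (All.lookup fx∉ (∈-map⁺ f y∈) eq)
  unique-map⇒injectiveOn f (fy∉ ∷ _)  (there x∈)  (here refl) eq =
    ⊥-elim (All.lookup fy∉ (∈-map⁺ f x∈) (sym eq))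
  unique-map⇒injectiveOn f (_ ∷ !fxs) (there x∈)  (there y∈)  eq = unique-map⇒injectiveOn f !fxs x∈ y∈ eq

module _ {A : Set} (_≟_ : DecidableEquality A) where

  open import Data.List.Membership.DecPropositional _≟_ using (_∈?_)

  private
    ∈-delete : ∀ {x y : A} us vs → x ∈ us ++ y ∷ vs → x ≢ y → x ∈ us ++ vs
    ∈-delete us vs x∈ x≢y with ∈-++⁻ us x∈
    ... | inj₁ x∈us         = ∈-++⁺ˡ x∈us
    ... | inj₂ (here x≡y)   = ⊥-elim (x≢y x≡y)
    ... | inj₂ (there x∈vs) = ∈-++⁺ʳ us x∈vs

  length-mono-⊆ : ∀ {xs ys : List A} → Unique xs → xs ⊆ ys → length xs ≤ length ys
  length-mono-⊆ {[]} _ _ = z≤n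
  length-mono-⊆ {x ∷ xs} (x∉xs ∷ !xs) xs⊆ys with ∈-∃++ (xs⊆ys (here refl))
  ... | us , vs , refl = subst (suc (length xs) ≤_) (sym (List.length-++-sucʳ us x vs))
    (s≤s (length-mono-⊆ !xs λ z∈xs →
      ∈-delete us vs (xs⊆ys (there z∈xs)) (λ { refl → All.lookup x∉xs z∈xs refl })))

  pigeonhole : ∀ {xs ys : List A} → Unique xs → xs ⊆ ys → length ys ≤ length xs → ys ⊆ xs
  pigeonhole {xs} {ys} !xs xs⊆ys ys≤xs {y} y∈ys with y ∈? xs
  ... | yes y∈xs = y∈xs
  ... | no  y∉xs = ⊥-elim (ℕ.<⇒≱ (length-mono-⊆ (All.¬Any⇒All¬ xs y∉xs ∷ !xs) y∷xs⊆ys) ys≤xs)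
    where
    y∷xs⊆ys : y ∷ xs ⊆ ys
    y∷xs⊆ys (here refl) = y∈ys
    y∷xs⊆ys (there z∈xs) = xs⊆ys z∈xs

  injectiveOn⇒map-↭ : ∀ (f : A → A) {xs} → Unique xs → (∀ {x} → x ∈ xs → f x ∈ xs) →
    InjectiveOn f xs → map f xs ↭ xs
  injectiveOn⇒map-↭ f {xs} !xs f-into f-inj = ∼bag⇒↭ (unique∧set⇒bag !fxs !xs (mk⇔ fxs⊆xs xs⊆fxs))
    where
    !fxs : Unique (map f xs)
    !fxs = unique-map⁺-injectiveOn f !xs f-inj
    fxs⊆xs : map f xs ⊆ xs
    fxs⊆xs z∈ with ∈-map⁻ f z∈
    ... | x , x∈ , refl = f-into x∈
    xs⊆fxs : xs ⊆ map f xs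
    xs⊆fxs = pigeonhole !fxs fxs⊆xs (ℕ.≤-reflexive (sym (List.length-map f xs)))

  count-reindex : ∀ (p : A → Bool) (f : A → A) {xs} → Unique xs → (∀ {x} → x ∈ xs → f x ∈ xs) →
    InjectiveOn f xs → count (p ∘ f) xs ≡ count p xs
  count-reindex p f {xs} !xs f-into f-inj =
    trans (sym (count-map p f xs)) (count-↭ p (injectiveOn⇒map-↭ f !xs f-into f-inj))

applyUpTo-cong : ∀ {A : Set} n {f g : ℕ → A} → (∀ i → i < n → f i ≡ g i) →
  applyUpTo f n ≡ applyUpTo g n
applyUpTo-cong zero    f≗g = refl
applyUpTo-cong (suc n) f≗g =
  cong₂ _∷_ (f≗g 0 (s≤s z≤n)) (applyUpTo-cong n λ i i<n → f≗g (suc i) (s≤s i<n))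

∑< : ℕ → (ℕ → ℕ) → ℕ
∑< n f = sum (applyUpTo f n)

syntax ∑< n (λ i → e) = ∑[ i < n ] e

∑-cong : ∀ n {f g : ℕ → ℕ} → (∀ i → i < n → f i ≡ g i) → ∑< n f ≡ ∑< n g
∑-cong zero    f≗g = refl
∑-cong (suc n) f≗g = cong₂ _+_ (f≗g 0 (s≤s z≤n)) (∑-cong n λ i i<n → f≗g (suc i) (s≤s i<n))

∑-distrib-+ : ∀ n (f g : ℕ → ℕ) → ∑[ i < n ] (f i + g i) ≡ ∑< n f + ∑< n g
∑-distrib-+ zero    f g = refl
∑-distrib-+ (suc n) f g = trans (cong (_+_ (f 0 + g 0)) (∑-distrib-+ n (f ∘ suc) (g ∘ suc)))
  (interchange (f 0) (g 0) (∑< n (f ∘ suc)) (∑< n (g ∘ suc)))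

∑-zero : ∀ n → ∑[ i < n ] 0 ≡ 0
∑-zero zero    = refl
∑-zero (suc n) = ∑-zero n

∑-comm : ∀ m n (F : ℕ → ℕ → ℕ) → ∑[ i < m ] ∑[ j < n ] F i j ≡ ∑[ j < n ] ∑[ i < m ] F i j
∑-comm zero    n F = sym (∑-zero n)
∑-comm (suc m) n F = trans (cong (_+_ (∑< n (F 0))) (∑-comm m n (F ∘ suc)))
  (sym (∑-distrib-+ n (F 0) λ j → ∑[ i < m ] F (suc i) j))

count-applyUpTo : ∀ {B : Set} (p : B → Bool) (f : ℕ → B) n →
  count p (applyUpTo f n) ≡ ∑[ i < n ] ⟦ p (f i) ⟧
count-applyUpTo p f zero = refl
count-applyUpTo p f (suc n) with p (f 0)
... | true  = cong suc (count-applyUpTo p (f ∘ suc) n)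
... | false = count-applyUpTo p (f ∘ suc) n

∑-reindex : ∀ n (π : ℕ → ℕ) → (∀ i → i < n → π i < n) →
  (∀ i j → i < n → j < n → π i ≡ π j → i ≡ j) → ∀ f → ∑< n (f ∘ π) ≡ ∑< n f
∑-reindex n π π-< π-inj f = begin
  sum (applyUpTo (f ∘ π) n)    ≡⟨ cong sum (List.map-applyUpTo π f n) ⟨
  sum (map f (applyUpTo π n))  ≡⟨ cong (sum ∘ map f) (List.map-upTo π n) ⟨
  sum (map f (map π (upTo n))) ≡⟨ sum-↭ (map⁺ f π-↭) ⟩
  sum (map f (upTo n))         ≡⟨ cong sum (List.map-upTo f n) ⟩
  sum (applyUpTo f n)          ∎
  where
  open ≡-Reasoning
  π-into : ∀ {i} → i ∈ upTo n → π i ∈ upTo n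
  π-into i∈ = ∈-upTo⁺ (π-< _ (∈-upTo⁻ i∈))
  π-inj′ : InjectiveOn π (upTo n)
  π-inj′ i∈ j∈ = π-inj _ _ (∈-upTo⁻ i∈) (∈-upTo⁻ j∈)
  π-↭ : map π (upTo n) ↭ upTo n
  π-↭ = injectiveOn⇒map-↭ ℕ._≟_ π (Unique.upTo⁺ n) π-into π-inj′

inversionCount : ℕ → (ℕ → ℕ) → ℕ
inversionCount n π = ∑[ i < n ] ∑[ l < n ] ⟦ (i <ᵇ l) ∧ (π l <ᵇ π i) ⟧

inversionCount-inverse : ∀ n (π ρ : ℕ → ℕ) → (∀ i → i < n → ρ i < n) →
  (∀ i → i < n → π (ρ i) ≡ i) → inversionCount n π ≡ inversionCount n ρ
inversionCount-inverse n π ρ ρ-< πρ = begin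
  inversionCount n π
    ≡⟨ ∑-reindex n ρ ρ-< ρ-inj (λ i → ∑[ l < n ] ⟦ (i <ᵇ l) ∧ (π l <ᵇ π i) ⟧) ⟨
  ∑[ a < n ] ∑[ l < n ] ⟦ (ρ a <ᵇ l) ∧ (π l <ᵇ π (ρ a)) ⟧
    ≡⟨ ∑-cong n (λ a _ → ∑-reindex n ρ ρ-< ρ-inj λ l → ⟦ (ρ a <ᵇ l) ∧ (π l <ᵇ π (ρ a)) ⟧) ⟨
  ∑[ a < n ] ∑[ b < n ] ⟦ (ρ a <ᵇ ρ b) ∧ (π (ρ b) <ᵇ π (ρ a)) ⟧
    ≡⟨ ∑-cong n (λ a a<n → ∑-cong n λ b b<n →
         cong₂ (λ x y → ⟦ (ρ a <ᵇ ρ b) ∧ (x <ᵇ y) ⟧) (πρ b b<n) (πρ a a<n)) ⟩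
  ∑[ a < n ] ∑[ b < n ] ⟦ (ρ a <ᵇ ρ b) ∧ (b <ᵇ a) ⟧
    ≡⟨ ∑-comm n n (λ a b → ⟦ (ρ a <ᵇ ρ b) ∧ (b <ᵇ a) ⟧) ⟩
  ∑[ b < n ] ∑[ a < n ] ⟦ (ρ a <ᵇ ρ b) ∧ (b <ᵇ a) ⟧
    ≡⟨ ∑-cong n (λ b _ → ∑-cong n λ a _ → cong ⟦_⟧ (∧-comm (ρ a <ᵇ ρ b) (b <ᵇ a))) ⟩
  inversionCount n ρ ∎
  where
  open ≡-Reasoning
  ρ-inj : ∀ i j → i < n → j < n → ρ i ≡ ρ j → i ≡ j
  ρ-inj i j i<n j<n ρi≡ρj = trans (sym (πρ i i<n)) (trans (cong π ρi≡ρj) (πρ j j<n))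

-- Foata's bijection for a strict total order

module Foata {A : Set} (_≻_ : A → A → Bool)
  (≻-irrefl : ∀ x → x ≻ x ≡ false)
  (≻-trans : ∀ {x y z} → x ≻ y ≡ true → y ≻ z ≡ true → x ≻ z ≡ true)
  (≻-connex : ∀ {x y} → x ≢ y → x ≻ y ≡ false → y ≻ x ≡ true)
  where

  ≻-asym : ∀ {x y} → x ≻ y ≡ true → y ≻ x ≡ false
  ≻-asym {x} {y} x≻y with y ≻ x in y≻x
  ... | false = refl
  ... | true  = trans (sym (≻-trans x≻y y≻x)) (≻-irrefl x)

  ≻-flip : ∀ {x y} → x ≢ y → x ≻ y ≡ not (y ≻ x)
  ≻-flip {x} {y} x≢y with x ≻ y in x≻y
  ... | true  = sym (cong not (≻-asym x≻y))
  ... | false = sym (cong not (≻-connex x≢y x≻y))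

  inversions : List A → ℕ
  inversions []      = 0
  inversions (x ∷ w) = count (x ≻_) w + inversions w

  majorIndexFrom : ℕ → List A → ℕ
  majorIndexFrom i []          = 0
  majorIndexFrom i (x ∷ [])    = 0
  majorIndexFrom i (x ∷ y ∷ w) = (if x ≻ y then i else 0) + majorIndexFrom (suc i) (y ∷ w)

  majorIndex : List A → ℕ
  majorIndex = majorIndexFrom 1

  lastOr : A → List A → A
  lastOr d []      = d
  lastOr d (y ∷ w) = lastOr y w

  lastOr-∷ʳ : ∀ d u x → lastOr d (u ∷ʳ x) ≡ x
  lastOr-∷ʳ d []      x = refl
  lastOr-∷ʳ d (y ∷ u) x = lastOr-∷ʳ y u x

  lastOr-∈ : ∀ y u → lastOr y u ∈ y ∷ u
  lastOr-∈ y []      = here refl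
  lastOr-∈ y (z ∷ u) = there (lastOr-∈ z u)

  inversions-swap : ∀ {a b} v → a ≻ b ≡ true → inversions (a ∷ b ∷ v) ≡ suc (inversions (b ∷ a ∷ v))
  inversions-swap {a} {b} v a≻b rewrite a≻b | ≻-asym a≻b =
    cong suc (x∙yz≈y∙xz (count (a ≻_) v) (count (b ≻_) v) (inversions v))

  inversions-∷ʳ : ∀ u x → inversions (u ∷ʳ x) ≡ inversions u + count (_≻ x) u
  inversions-∷ʳ []      x = refl
  inversions-∷ʳ (y ∷ u) x = begin
    count (y ≻_) (u ∷ʳ x) + inversions (u ∷ʳ x)
      ≡⟨ cong₂ _+_ (count-∷ʳ (y ≻_) u x) (inversions-∷ʳ u x) ⟩
    (count (y ≻_) u + ⟦ y ≻ x ⟧) + (inversions u + count (_≻ x) u)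
      ≡⟨ interchange (count (y ≻_) u) ⟦ y ≻ x ⟧ (inversions u) (count (_≻ x) u) ⟩
    inversions (y ∷ u) + (⟦ y ≻ x ⟧ + count (_≻ x) u)
      ≡⟨ cong (_+_ (inversions (y ∷ u))) (count-∷ (_≻ x) y u) ⟨
    inversions (y ∷ u) + count (_≻ x) (y ∷ u) ∎
    where open ≡-Reasoning

  majorIndexFrom-∷ʳ : ∀ i u x → majorIndexFrom (suc i) (u ∷ʳ x) ≡
    majorIndexFrom (suc i) u + (if lastOr x u ≻ x then i + length u else 0)
  majorIndexFrom-∷ʳ i [] x rewrite ≻-irrefl x = refl
  majorIndexFrom-∷ʳ i (y ∷ []) x with y ≻ x
  ... | true  = trans (ℕ.+-identityʳ (suc i)) (ℕ.+-comm 1 i)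
  ... | false = refl
  majorIndexFrom-∷ʳ i (y ∷ z ∷ u) x
    rewrite majorIndexFrom-∷ʳ (suc i) (z ∷ u) x | ℕ.+-suc i (suc (length u)) =
    sym (ℕ.+-assoc (if y ≻ z then suc i else 0) _ _)

  insertSecond : A → List A → List A
  insertSecond y []      = y ∷ []
  insertSecond y (c ∷ v) = c ∷ y ∷ v

  -- Cuts the word after every letter satisfying p and moves the last letter of each block to the
  -- front of the block.  A letter failing p is put right behind the head of the rotated rest,
  -- which is the letter closing its block.
  rotateBlocks : (A → Bool) → List A → List A
  rotateBlocks p []       = []
  rotateBlocks p (y ∷ ys) = if p y then y ∷ rotateBlocks p ys else insertSecond y (rotateBlocks p ys)

  EndsWith : (A → Bool) → List A → Set
  EndsWith p []           = ⊤
  EndsWith p (y ∷ [])     = p y ≡ true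
  EndsWith p (_ ∷ z ∷ zs) = EndsWith p (z ∷ zs)

  StartsWith : (A → Bool) → List A → Set
  StartsWith p []      = ⊤
  StartsWith p (c ∷ _) = p c ≡ true

  endsWith-∷ : ∀ {p} y ys → EndsWith p (y ∷ ys) → EndsWith p ys
  endsWith-∷ y []       _ = tt
  endsWith-∷ y (_ ∷ _) e = e

  endsWith-lastOr : ∀ {p} d u → p (lastOr d u) ≡ true → EndsWith p u
  endsWith-lastOr d []          _ = tt
  endsWith-lastOr d (y ∷ [])    e = e
  endsWith-lastOr d (y ∷ z ∷ u) e = endsWith-lastOr y (z ∷ u) e

  module _ (p : A → Bool) where

    rotateBlocks-↭ : ∀ u → rotateBlocks p u ↭ u
    rotateBlocks-↭ []       = ↭-refl
    rotateBlocks-↭ (y ∷ ys) with p y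
    ... | true  = prep y (rotateBlocks-↭ ys)
    ... | false = ↭-trans (insertSecond-↭ (rotateBlocks p ys)) (prep y (rotateBlocks-↭ ys))
      where
      insertSecond-↭ : ∀ v → insertSecond y v ↭ y ∷ v
      insertSecond-↭ []      = ↭-refl
      insertSecond-↭ (c ∷ v) = swap c y ↭-refl

    rotateBlocks-≡[] : ∀ u → rotateBlocks p u ≡ [] → u ≡ []
    rotateBlocks-≡[] u eq = ↭-empty-inv (↭-sym (subst (_↭ u) eq (rotateBlocks-↭ u)))

    rotateBlocks-head : ∀ {y ys} → EndsWith p (y ∷ ys) → p y ≡ false →
      ∃₂ λ c v → rotateBlocks p ys ≡ c ∷ v × p c ≡ true
    rotateBlocks-head {y} {[]}     e py = ⊥-elim (not-¬ e py) 
    rotateBlocks-head {y} {z ∷ zs} e py with p z in pz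
    ... | true  = z , rotateBlocks p zs , refl , pz
    ... | false with rotateBlocks-head {z} {zs} e pz
    ...   | c , v , eq , pc rewrite eq = c , z ∷ v , refl , pc

    rotateBlocks-startsWith : ∀ u → EndsWith p u → StartsWith p (rotateBlocks p u)
    rotateBlocks-startsWith []       _ = tt
    rotateBlocks-startsWith (y ∷ ys) e with p y in py
    ... | true  = py
    ... | false with rotateBlocks-head {y} {ys} e py
    ...   | c , v , eq , pc rewrite eq = pc

    private
      ∈-rotateBlocks-head : ∀ {ys c v} → rotateBlocks p ys ≡ c ∷ v → c ∈ ys
      ∈-rotateBlocks-head {ys} eq = ∈-resp-↭ (rotateBlocks-↭ ys) (subst (_ ∈_) (sym eq) (here refl))

      inversions-∷-gain : ∀ y ys {k} → inversions (rotateBlocks p ys) ≡ inversions ys + k →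
        inversions (y ∷ rotateBlocks p ys) ≡ inversions (y ∷ ys) + k
      inversions-∷-gain y ys {k} ih =
        trans (cong₂ _+_ (count-↭ (y ≻_) (rotateBlocks-↭ ys)) ih)
              (sym (ℕ.+-assoc (count (y ≻_) ys) (inversions ys) k))

      inversions-∷-loss : ∀ y ys {k} → inversions (rotateBlocks p ys) + k ≡ inversions ys →
        inversions (y ∷ rotateBlocks p ys) + k ≡ inversions (y ∷ ys)
      inversions-∷-loss y ys {k} ih =
        trans (ℕ.+-assoc (count (y ≻_) (rotateBlocks p ys)) _ k)
              (cong₂ _+_ (count-↭ (y ≻_) (rotateBlocks-↭ ys)) ih)

    CutsAbove CutsBelow : List A → Set
    CutsAbove u = ∀ {c y} → c ∈ u → y ∈ u → p c ≡ true → p y ≡ false → c ≻ y ≡ true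
    CutsBelow u = ∀ {c y} → c ∈ u → y ∈ u → p c ≡ true → p y ≡ false → y ≻ c ≡ true

    rotateBlocks-inversions-above : ∀ u → EndsWith p u → CutsAbove u →
      inversions (rotateBlocks p u) ≡ inversions u + count (not ∘ p) u
    rotateBlocks-inversions-above []       _ _ = refl
    rotateBlocks-inversions-above (y ∷ ys) e above with p y in py
    ... | true  = inversions-∷-gain y ys IH
      where IH = rotateBlocks-inversions-above ys (endsWith-∷ y ys e) λ c∈ y∈ → above (there c∈) (there y∈)
    ... | false with rotateBlocks-head {y} {ys} e py
    ...   | c , v , eq , pc = begin
      inversions (insertSecond y (rotateBlocks p ys))
        ≡⟨ cong (inversions ∘ insertSecond y) eq ⟩
      inversions (c ∷ y ∷ v)
        ≡⟨ inversions-swap v (above (there (∈-rotateBlocks-head eq)) (here refl) pc py) ⟩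
      suc (inversions (y ∷ c ∷ v))
        ≡⟨ cong (λ w → suc (inversions (y ∷ w))) eq ⟨
      suc (inversions (y ∷ rotateBlocks p ys))
        ≡⟨ cong suc (inversions-∷-gain y ys IH) ⟩
      suc (inversions (y ∷ ys) + count (not ∘ p) ys)
        ≡⟨ ℕ.+-suc _ _ ⟨
      inversions (y ∷ ys) + suc (count (not ∘ p) ys) ∎
      where
      open ≡-Reasoning
      IH = rotateBlocks-inversions-above ys (endsWith-∷ y ys e) λ c∈ y∈ → above (there c∈) (there y∈)

    rotateBlocks-inversions-below : ∀ u → EndsWith p u → CutsBelow u →
      inversions (rotateBlocks p u) + count (not ∘ p) u ≡ inversions u
    rotateBlocks-inversions-below []       _ _ = refl
    rotateBlocks-inversions-below (y ∷ ys) e below with p y in py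
    ... | true  = inversions-∷-loss y ys IH
      where IH = rotateBlocks-inversions-below ys (endsWith-∷ y ys e) λ c∈ y∈ → below (there c∈) (there y∈)
    ... | false with rotateBlocks-head {y} {ys} e py
    ...   | c , v , eq , pc = begin
      inversions (insertSecond y (rotateBlocks p ys)) + suc (count (not ∘ p) ys)
        ≡⟨ cong (λ w → inversions (insertSecond y w) + _) eq ⟩
      inversions (c ∷ y ∷ v) + suc (count (not ∘ p) ys)
        ≡⟨ ℕ.+-suc _ _ ⟩
      suc (inversions (c ∷ y ∷ v)) + count (not ∘ p) ys
        ≡⟨ cong (_+ count (not ∘ p) ys)
             (inversions-swap v (below (there (∈-rotateBlocks-head eq)) (here refl) pc py)) ⟨
      inversions (y ∷ c ∷ v) + count (not ∘ p) ys
        ≡⟨ cong (λ w → inversions (y ∷ w) + _) eq ⟨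
      inversions (y ∷ rotateBlocks p ys) + count (not ∘ p) ys
        ≡⟨ inversions-∷-loss y ys IH ⟩
      inversions (y ∷ ys) ∎
      where
      open ≡-Reasoning
      IH = rotateBlocks-inversions-below ys (endsWith-∷ y ys e) λ c∈ y∈ → below (there c∈) (there y∈)

    rotateBlocks-injective : ∀ u u′ → EndsWith p u → EndsWith p u′ →
      rotateBlocks p u ≡ rotateBlocks p u′ → u ≡ u′
    rotateBlocks-injective []       []         _ _  _  = refl
    rotateBlocks-injective []       (y′ ∷ ys′) _ _  eq with () ← rotateBlocks-≡[] (y′ ∷ ys′) (sym eq)
    rotateBlocks-injective (y ∷ ys) []         _ _  eq with () ← rotateBlocks-≡[] (y ∷ ys) eq
    rotateBlocks-injective (y ∷ ys) (y′ ∷ ys′) e e′ eq with p y in py | p y′ in py′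
    ... | true  | true  with List.∷-injective eq
    ...   | refl , eq′ =
      cong (y ∷_) (rotateBlocks-injective ys ys′ (endsWith-∷ y ys e) (endsWith-∷ y′ ys′ e′) eq′)
    rotateBlocks-injective (y ∷ ys) (y′ ∷ ys′) e e′ eq | true  | false
      with rotateBlocks-head {y′} {ys′} e′ py′
    ...   | c , v , h , _ =
      ⊥-elim (not-¬ (subst (StartsWith p) (List.∷-injectiveʳ (trans eq (cong (insertSecond y′) h)))
                                         (rotateBlocks-startsWith ys (endsWith-∷ y ys e))) py′)
    rotateBlocks-injective (y ∷ ys) (y′ ∷ ys′) e e′ eq | false | true  with rotateBlocks-head {y} {ys} e py
    ...   | c , v , h , _ =
      ⊥-elim (not-¬ (subst (StartsWith p) (List.∷-injectiveʳ (trans (sym eq) (cong (insertSecond y) h)))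
                                         (rotateBlocks-startsWith ys′ (endsWith-∷ y′ ys′ e′))) py)
    rotateBlocks-injective (y ∷ ys) (y′ ∷ ys′) e e′ eq | false | false
      with rotateBlocks-head {y} {ys} e py | rotateBlocks-head {y′} {ys′} e′ py′
    ...   | c , v , h , _ | c′ , v′ , h′ , _
      with trans (sym (cong (insertSecond y) h)) (trans eq (cong (insertSecond y′) h′))
    ...     | refl =
      cong (y ∷_) (rotateBlocks-injective ys ys′ (endsWith-∷ y ys e) (endsWith-∷ y′ ys′ e′) (trans h (sym h′)))

    rotateBlocks-filter : ∀ (q : A → Bool) u → EndsWith p u →
      (∀ {c y} → c ∈ u → y ∈ u → p c ≡ true → p y ≡ false → q c ≡ true → q y ≡ true → ⊥) →
      filterᵇ q (rotateBlocks p u) ≡ filterᵇ q u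
    rotateBlocks-filter q []       _ _   = refl
    rotateBlocks-filter q (y ∷ ys) e sep with p y in py
    ... | true  = filterᵇ-∷-cong q y IH
      where IH = rotateBlocks-filter q ys (endsWith-∷ y ys e) λ c∈ y∈ → sep (there c∈) (there y∈)
    ... | false with rotateBlocks-head {y} {ys} e py
    ...   | c , v , h , pc = begin
      filterᵇ q (insertSecond y (rotateBlocks p ys))
        ≡⟨ cong (filterᵇ q ∘ insertSecond y) h ⟩
      filterᵇ q (c ∷ y ∷ v)
        ≡⟨ filterᵇ-swap q v (sep (there (∈-rotateBlocks-head h)) (here refl) pc py) ⟩
      filterᵇ q (y ∷ c ∷ v)
        ≡⟨ cong (filterᵇ q ∘ (y ∷_)) h ⟨
      filterᵇ q (y ∷ rotateBlocks p ys)
        ≡⟨ filterᵇ-∷-cong q y IH ⟩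
      filterᵇ q (y ∷ ys) ∎
      where
      open ≡-Reasoning
      IH = rotateBlocks-filter q ys (endsWith-∷ y ys e) λ c∈ y∈ → sep (there c∈) (there y∈)

  -- Foata's γ_x: the blocks end with the letters on the same side of x as the last letter of u.
  γ : A → List A → List A
  γ x u = if lastOr x u ≻ x then rotateBlocks (_≻ x) u else rotateBlocks (x ≻_) u

  γ-↭ : ∀ x u → γ x u ↭ u
  γ-↭ x u with lastOr x u ≻ x
  ... | true  = rotateBlocks-↭ (_≻ x) u
  ... | false = rotateBlocks-↭ (x ≻_) u

  private
    ∉⇒≢ : ∀ {x z : A} {u} → x ∉ u → z ∈ u → z ≢ x
    ∉⇒≢ x∉u z∈u refl = x∉u z∈u

    endsWith-below : ∀ {x : A} u → x ∉ u → lastOr x u ≻ x ≡ false → EndsWith (x ≻_) u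
    endsWith-below []      _   _ = tt
    endsWith-below {x} (y ∷ u) x∉u e = endsWith-lastOr x (y ∷ u) (≻-connex (∉⇒≢ x∉u (lastOr-∈ y u)) e)

    startsWith-both : ∀ {x : A} v → StartsWith (_≻ x) v → StartsWith (x ≻_) v → v ≡ []
    startsWith-both []      _   _   = refl
    startsWith-both (c ∷ v) c≻x x≻c with () ← trans (sym (≻-asym c≻x)) x≻c

    rotateBlocks-above≢below : ∀ {x : A} u u′ → lastOr x u ≻ x ≡ true → EndsWith (x ≻_) u′ →
      rotateBlocks (_≻ x) u ≢ rotateBlocks (x ≻_) u′
    rotateBlocks-above≢below {x} u u′ e f eq
      with rotateBlocks-≡[] (_≻ x) u (trans eq (startsWith-both (rotateBlocks (x ≻_) u′)
             (subst (StartsWith (_≻ x)) eq (rotateBlocks-startsWith (_≻ x) u (endsWith-lastOr x u e)))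
             (rotateBlocks-startsWith (x ≻_) u′ f)))
    ... | refl = not-¬ e (≻-irrefl x)

  -- Rotating a block moves its cut letter past the other letters of the block, which all lie on the
  -- other side of x: above x this creates one inversion per such letter, below x it removes one.
  inversions-γ : ∀ x u → x ∉ u →
    inversions (γ x u) + count (_≻ x) u ≡ inversions u + (if lastOr x u ≻ x then length u else 0)
  inversions-γ x u x∉u with lastOr x u ≻ x in e
  ... | true  = begin
    inversions (rotateBlocks (_≻ x) u) + count (_≻ x) u
      ≡⟨ cong (_+ count (_≻ x) u) (rotateBlocks-inversions-above (_≻ x) u (endsWith-lastOr x u e) above) ⟩
    inversions u + count (not ∘ (_≻ x)) u + count (_≻ x) u
      ≡⟨ ℕ.+-assoc (inversions u) _ _ ⟩
    inversions u + (count (not ∘ (_≻ x)) u + count (_≻ x) u)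
      ≡⟨ cong (_+_ (inversions u)) (trans (ℕ.+-comm (count (not ∘ (_≻ x)) u) _) (count-+-count-not (_≻ x) u)) ⟩
    inversions u + length u ∎
    where
    open ≡-Reasoning
    above : CutsAbove (_≻ x) u
    above _ y∈u c≻x y⊁x = ≻-trans c≻x (≻-connex (∉⇒≢ x∉u y∈u) y⊁x)
  ... | false = begin
    inversions (rotateBlocks (x ≻_) u) + count (_≻ x) u
      ≡⟨ cong (_+_ (inversions (rotateBlocks (x ≻_) u))) (count-cong u λ z∈u → ≻-flip (∉⇒≢ x∉u z∈u)) ⟩
    inversions (rotateBlocks (x ≻_) u) + count (not ∘ (x ≻_)) u
      ≡⟨ rotateBlocks-inversions-below (x ≻_) u (endsWith-below u x∉u e) below ⟩
    inversions u
      ≡⟨ ℕ.+-identityʳ _ ⟨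
    inversions u + 0 ∎
    where
    open ≡-Reasoning
    below : CutsBelow (x ≻_) u
    below _ y∈u x≻c x⊁y = ≻-trans (≻-connex (∉⇒≢ x∉u y∈u ∘ sym) x⊁y) x≻c

  γ-injective : ∀ x u u′ → x ∉ u → x ∉ u′ → γ x u ≡ γ x u′ → u ≡ u′
  γ-injective x u u′ x∉u x∉u′ eq with lastOr x u ≻ x in e | lastOr x u′ ≻ x in e′
  ... | true  | true  = rotateBlocks-injective (_≻ x) u u′ (endsWith-lastOr x u e) (endsWith-lastOr x u′ e′) eq
  ... | false | false =
    rotateBlocks-injective (x ≻_) u u′ (endsWith-below u x∉u e) (endsWith-below u′ x∉u′ e′) eq
  ... | true  | false = ⊥-elim (rotateBlocks-above≢below u u′ e (endsWith-below u′ x∉u′ e′) eq)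
  ... | false | true  = ⊥-elim (rotateBlocks-above≢below u′ u e′ (endsWith-below u x∉u e) (sym eq))

  Consecutive : (A → Bool) → List A → Set
  Consecutive q w = ∀ {x y z} → x ∈ w → y ∈ w → z ∈ w → q y ≡ true → q z ≡ true →
    z ≻ x ≡ true → x ≻ y ≡ true → ⊥

  consecutive-⊆ : ∀ {q w w′} → w′ ⊆ w → Consecutive q w → Consecutive q w′
  consecutive-⊆ w′⊆w cons x∈ y∈ z∈ = cons (w′⊆w x∈) (w′⊆w y∈) (w′⊆w z∈)

  γ-filter : ∀ q x u → x ∉ u → Consecutive q (x ∷ u) → filterᵇ q (γ x u) ≡ filterᵇ q u
  γ-filter q x u x∉u cons with lastOr x u ≻ x in e
  ... | true  = rotateBlocks-filter (_≻ x) q u (endsWith-lastOr x u e) λ c∈u y∈u c≻x y⊁x qc qy →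
    cons (here refl) (there y∈u) (there c∈u) qy qc c≻x (≻-connex (∉⇒≢ x∉u y∈u) y⊁x)
  ... | false = rotateBlocks-filter (x ≻_) q u (endsWith-below u x∉u e) λ c∈u y∈u x≻c x⊁y qc qy →
    cons (here refl) (there c∈u) (there y∈u) qc qy (≻-connex (∉⇒≢ x∉u y∈u ∘ sym) x⊁y) x≻c

  -- foataᴿ r is Foata's image of reverse r, so the head of r is the letter inserted last.
  foataᴿ : List A → List A
  foataᴿ []      = []
  foataᴿ (x ∷ r) = γ x (foataᴿ r) ∷ʳ x

  foata : List A → List A
  foata w = foataᴿ (reverse w)

  foataᴿ-↭ : ∀ r → foataᴿ r ↭ r
  foataᴿ-↭ []      = ↭-refl
  foataᴿ-↭ (x ∷ r) =
    ↭-trans (++⁺ʳ (x ∷ []) (↭-trans (γ-↭ x (foataᴿ r)) (foataᴿ-↭ r))) (↭-sym (∷↭∷ʳ x r))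

  foataᴿ-lastOr : ∀ d r → lastOr d (foataᴿ r) ≡ lastOr d (reverse r)
  foataᴿ-lastOr d []      = refl
  foataᴿ-lastOr d (x ∷ r) = trans (lastOr-∷ʳ d (γ x (foataᴿ r)) x)
    (sym (trans (cong (lastOr d) (List.unfold-reverse x r)) (lastOr-∷ʳ d (reverse r) x)))

  private
    ∉-foataᴿ : ∀ {x r} → All (x ≢_) r → x ∉ foataᴿ r
    ∉-foataᴿ {x} {r} x∉r x∈ = All.All¬⇒¬Any x∉r (∈-resp-↭ (foataᴿ-↭ r) x∈)

  foataᴿ-inversions : ∀ r → Unique r → inversions (foataᴿ r) ≡ majorIndex (reverse r)
  foataᴿ-inversions []      _           = refl
  foataᴿ-inversions (x ∷ r) (x∉r ∷ !r) = begin
    inversions (γ x F ∷ʳ x)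
      ≡⟨ inversions-∷ʳ (γ x F) x ⟩
    inversions (γ x F) + count (_≻ x) (γ x F)
      ≡⟨ cong (_+_ (inversions (γ x F))) (count-↭ (_≻ x) (γ-↭ x F)) ⟩
    inversions (γ x F) + count (_≻ x) F
      ≡⟨ inversions-γ x F (∉-foataᴿ x∉r) ⟩
    inversions F + (if lastOr x F ≻ x then length F else 0)
      ≡⟨ cong₂ _+_ (foataᴿ-inversions r !r)
           (cong₂ (λ l n → if l ≻ x then n else 0) (foataᴿ-lastOr x r)
             (trans (↭-length (foataᴿ-↭ r)) (sym (List.length-reverse r)))) ⟩
    majorIndex (reverse r) + (if lastOr x (reverse r) ≻ x then length (reverse r) else 0)
      ≡⟨ majorIndexFrom-∷ʳ 0 (reverse r) x ⟨
    majorIndex (reverse r ∷ʳ x)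
      ≡⟨ cong majorIndex (List.unfold-reverse x r) ⟨
    majorIndex (reverse (x ∷ r)) ∎
    where
    open ≡-Reasoning
    F = foataᴿ r

  foataᴿ-injective : ∀ r r′ → Unique r → Unique r′ → foataᴿ r ≡ foataᴿ r′ → r ≡ r′
  foataᴿ-injective []      []        _          _            _  = refl
  foataᴿ-injective []      (x′ ∷ r′) _          _            eq with () ← List.++-conicalʳ _ (x′ ∷ []) (sym eq)
  foataᴿ-injective (x ∷ r) []        _          _            eq with () ← List.++-conicalʳ _ (x ∷ []) eq
  foataᴿ-injective (x ∷ r) (x′ ∷ r′) (x∉r ∷ !r) (x′∉r′ ∷ !r′) eq
    with List.∷ʳ-injective (γ x (foataᴿ r)) (γ x′ (foataᴿ r′)) eq
  ... | γ≡ , refl =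
    cong (x ∷_) (foataᴿ-injective r r′ !r !r′ (γ-injective x _ _ (∉-foataᴿ x∉r) (∉-foataᴿ x′∉r′) γ≡))

  foataᴿ-filter : ∀ q r → Unique r → Consecutive q r → filterᵇ q (foataᴿ r) ≡ filterᵇ q (reverse r)
  foataᴿ-filter q []      _           _    = refl
  foataᴿ-filter q (x ∷ r) (x∉r ∷ !r) cons = begin
    filterᵇ q (γ x F ∷ʳ x)
      ≡⟨ List.filter-++ (T? ∘ q) (γ x F) (x ∷ []) ⟩
    filterᵇ q (γ x F) ++ filterᵇ q (x ∷ [])
      ≡⟨ cong (_++ filterᵇ q (x ∷ [])) (trans γ-step IH) ⟩
    filterᵇ q (reverse r) ++ filterᵇ q (x ∷ [])
      ≡⟨ List.filter-++ (T? ∘ q) (reverse r) (x ∷ []) ⟨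
    filterᵇ q (reverse r ∷ʳ x)
      ≡⟨ cong (filterᵇ q) (List.unfold-reverse x r) ⟨
    filterᵇ q (reverse (x ∷ r)) ∎
    where
    open ≡-Reasoning
    F = foataᴿ r
    IH = foataᴿ-filter q r !r (consecutive-⊆ there cons)
    γ-step = γ-filter q x F (∉-foataᴿ x∉r)
      (consecutive-⊆ (λ { (here refl) → here refl ; (there z∈) → there (∈-resp-↭ (foataᴿ-↭ r) z∈) }) cons)

  private
    unique-reverse : ∀ {w : List A} → Unique w → Unique (reverse w)
    unique-reverse {w} = unique-↭ (↭-sym (↭-reverse w))

  foata-↭ : ∀ w → foata w ↭ w
  foata-↭ w = ↭-trans (foataᴿ-↭ (reverse w)) (↭-reverse w)

  foata-inversions : ∀ w → Unique w → inversions (foata w) ≡ majorIndex w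
  foata-inversions w !w =
    trans (foataᴿ-inversions (reverse w) (unique-reverse !w)) (cong majorIndex (List.reverse-involutive w))

  foata-injective : ∀ w w′ → Unique w → Unique w′ → foata w ≡ foata w′ → w ≡ w′
  foata-injective w w′ !w !w′ eq =
    List.reverse-injective (foataᴿ-injective (reverse w) (reverse w′) (unique-reverse !w) (unique-reverse !w′) eq)

  foata-filter : ∀ q w → Unique w → Consecutive q w → filterᵇ q (foata w) ≡ filterᵇ q w
  foata-filter q w !w cons =
    trans (foataᴿ-filter q (reverse w) (unique-reverse !w) (consecutive-⊆ (∈-resp-↭ (↭-reverse w)) cons))
          (cong (filterᵇ q) (List.reverse-involutive w))

-- The friends order

key≤2∣∣ : ∀ v → key v ≤ 2 * ∣ v ∣
key≤2∣∣ (+ m)    = ℕ.m∸n≤m (2 * m) 1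
key≤2∣∣ -[1+ m ] = ℕ.≤-refl

2∣∣≤1+key : ∀ v → 2 * ∣ v ∣ ≤ suc (key v)
2∣∣≤1+key (+ m)    = ℕ.m≤n+m∸n (2 * m) 1
2∣∣≤1+key -[1+ m ] = ℕ.n≤1+n _

∣∣<⇒key< : ∀ v w → ∣ v ∣ < ∣ w ∣ → key v < key w
∣∣<⇒key< v w ∣v∣<∣w∣ = s≤s⁻¹ (begin
  suc (suc (key v))     ≤⟨ s≤s (s≤s (key≤2∣∣ v)) ⟩
  suc (suc (2 * ∣ v ∣)) ≡⟨ ℕ.*-suc 2 ∣ v ∣ ⟨
  2 * suc ∣ v ∣         ≤⟨ ℕ.*-monoʳ-≤ 2 ∣v∣<∣w∣ ⟩
  2 * ∣ w ∣             ≤⟨ 2∣∣≤1+key w ⟩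
  suc (key w)           ∎)
  where open ℕ.≤-Reasoning

key<⇒∣∣≤ : ∀ v w → key v < key w → ∣ v ∣ ≤ ∣ w ∣
key<⇒∣∣≤ v w kv<kw = ℕ.≮⇒≥ λ ∣w∣<∣v∣ → ℕ.<-asym kv<kw (∣∣<⇒key< w v ∣w∣<∣v∣)

key-+suc : ∀ c → key (+ suc c) ≡ suc (2 * c)
key-+suc c = cong (_∸ 1) (ℕ.*-suc 2 c)

key-injective : ∀ {x y} → key x ≡ key y → x ≡ y
key-injective {+ zero}    {+ zero}    _ = refl
key-injective {+ zero}    {+ suc d}   e with () ← trans e (key-+suc d)
key-injective {+ suc c}   {+ zero}    e with () ← trans (sym e) (key-+suc c)
key-injective {+ suc c}   {+ suc d}   e =
  cong (+_ ∘ suc) (ℕ.*-cancelˡ-≡ c d 2 (ℕ.suc-injective (trans (sym (key-+suc c)) (trans e (key-+suc d)))))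
key-injective {+ suc c}   { -[1+ d ]} e = ⊥-elim (ℕ.even≢odd (suc d) c (trans (sym e) (key-+suc c)))
key-injective { -[1+ c ]} {+ suc d}   e = ⊥-elim (ℕ.even≢odd (suc c) d (trans e (key-+suc d)))
key-injective { -[1+ c ]} { -[1+ d ]} e = cong -[1+_] (ℕ.suc-injective (ℕ.*-cancelˡ-≡ (suc c) (suc d) 2 e))

>F-irrefl : ∀ x → (x >F x) ≡ false
>F-irrefl x = dec-false (key x ℕ.<? key x) (ℕ.<-irrefl refl)

>F-trans : ∀ {x y z} → (x >F y) ≡ true → (y >F z) ≡ true → (x >F z) ≡ true
>F-trans {x} {y} {z} x>y y>z = dec-true (key z ℕ.<? key x) (ℕ.<-trans (<ᵇ≡true⇒< y>z) (<ᵇ≡true⇒< x>y))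

>F-connex : ∀ {x y} → x ≢ y → (x >F y) ≡ false → (y >F x) ≡ true
>F-connex {x} {y} x≢y x≯y = dec-true (key x ℕ.<? key y)
  (ℕ.≤∧≢⇒< (ℕ.≮⇒≥ (<ᵇ≡false⇒≮ x≯y)) (x≢y ∘ key-injective))

>F-abs : ∀ x y → ∣ x ∣ ≢ ∣ y ∣ → (x >F y) ≡ (∣ y ∣ <ᵇ ∣ x ∣)
>F-abs x y ∣x∣≢∣y∣ with ℕ.<-cmp ∣ x ∣ ∣ y ∣
... | tri< lt _ _ =
  trans (dec-false (key y ℕ.<? key x) (ℕ.<⇒≯ (∣∣<⇒key< x y lt)))
        (sym (dec-false (∣ y ∣ ℕ.<? ∣ x ∣) (ℕ.<⇒≯ lt)))
... | tri≈ _ eq _ = ⊥-elim (∣x∣≢∣y∣ eq)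
... | tri> _ _ gt =
  trans (dec-true (key y ℕ.<? key x) (∣∣<⇒key< y x gt)) (sym (dec-true (∣ y ∣ ℕ.<? ∣ x ∣) gt))

module F = Foata _>F_ >F-irrefl (λ {x y z} → >F-trans {x} {y} {z}) (λ {x y} → >F-connex {x} {y})

invF≡inversions : ∀ w → invF w ≡ F.inversions w
invF≡inversions []      = refl
invF≡inversions (x ∷ w) = cong (_+_ (count (x >F_) w)) (invF≡inversions w)

majFrom≡majorIndexFrom : ∀ i w → majFrom i w ≡ F.majorIndexFrom i w
majFrom≡majorIndexFrom i []          = refl
majFrom≡majorIndexFrom i (x ∷ [])    = refl
majFrom≡majorIndexFrom i (x ∷ y ∷ w) =
  cong (_+_ (if x >F y then i else 0)) (majFrom≡majorIndexFrom (suc i) (y ∷ w))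

-- The helper of noRepeat is local to its where-block; unifying against the unfolding of noRepeat
-- in noRepeat-∷∷ gives it the name notInᴰ.
private
  mutual
    notInᴰ : ℕ → List ℕ → List ℕ → Bool
    notInᴰ = _

    noRepeat-∷∷ : ∀ x y ys →
      noRepeat (x ∷ y ∷ ys) ≡ (if x ≡ᵇ y then false else notInᴰ x (y ∷ ys) ys) ∧ noRepeat (y ∷ ys)
    noRepeat-∷∷ x y ys with y ∷ ys
    ... | _ = refl

  notInᴰ-sound : ∀ x xs ys → T (notInᴰ x xs ys) → All (x ≢_) ys
  notInᴰ-sound x xs []       _ = []
  notInᴰ-sound x xs (y ∷ ys) t with x ≡ᵇ y in x≟y
  ... | false = ≡ᵇ≡false⇒≢ x≟y ∷ notInᴰ-sound x xs ys t

  notInᴰ-complete : ∀ x xs ys → All (x ≢_) ys → T (notInᴰ x xs ys)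
  notInᴰ-complete x xs []       _            = tt
  notInᴰ-complete x xs (y ∷ ys) (x≢y ∷ x∉ys) with x ≡ᵇ y in x≟y
  ... | false = notInᴰ-complete x xs ys x∉ys
  ... | true  = x≢y (≡ᵇ≡true⇒≡ x≟y)

noRepeat⇒Unique : ∀ xs → T (noRepeat xs) → Unique xs
noRepeat⇒Unique []       _ = []
noRepeat⇒Unique (x ∷ xs) t with t₁ , t₂ ← Equivalence.to T-∧ t =
  notInᴰ-sound x xs xs t₁ ∷ noRepeat⇒Unique xs t₂

Unique⇒noRepeat : ∀ xs → Unique xs → T (noRepeat xs)
Unique⇒noRepeat []       _            = tt
Unique⇒noRepeat (x ∷ xs) (x∉xs ∷ !xs) =
  Equivalence.from T-∧ (notInᴰ-complete x xs xs x∉xs , Unique⇒noRepeat xs !xs)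

module _ {A : Set} where

  ∈-words⁻ : ∀ k (L : List A) {w} → w ∈ words k L → length w ≡ k × All (_∈ L) w
  ∈-words⁻ zero    L (here refl) = refl , []
  ∈-words⁻ (suc k) L w∈
    with x , x∈L , w∈′ ← find (∈-concatMap⁻ (λ x → map (x ∷_) (words k L)) {xs = L} w∈)
    with w′ , w′∈ , refl ← ∈-map⁻ (x ∷_) w∈′
    with len , w′⊆L ← ∈-words⁻ k L w′∈ = cong suc len , x∈L ∷ w′⊆L

  ∈-words⁺ : ∀ k (L : List A) {w} → length w ≡ k → All (_∈ L) w → w ∈ words k L
  ∈-words⁺ zero    L {[]}    _   []            = here refl
  ∈-words⁺ (suc k) L {x ∷ w} len (x∈L ∷ w⊆L) =
    ∈-concatMap⁺ (λ y → map (y ∷_) (words k L)) {xs = L}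
      (lose x∈L (∈-map⁺ (x ∷_) (∈-words⁺ k L (ℕ.suc-injective len) w⊆L)))

  words-unique : ∀ k {L : List A} → Unique L → Unique (words k L)
  words-unique zero    _  = [] ∷ []
  words-unique (suc k) {L} !L = go !L
    where
    W = words k L
    go : ∀ {M} → Unique M → Unique (concatMap (λ x → map (x ∷_) W) M)
    go []           = []
    go {x ∷ M} (x∉M ∷ !M) = Unique.++⁺ (Unique.map⁺ List.∷-injectiveʳ (words-unique k !L)) (go !M) disjoint
      where
      disjoint : ∀ {v} → ¬ (v ∈ map (x ∷_) W × v ∈ concatMap (λ y → map (y ∷_) W) M)
      disjoint (v∈ , v∈′)
        with _ , _ , refl ← ∈-map⁻ (x ∷_) v∈
        with y , y∈M , v∈″ ← find (∈-concatMap⁻ (λ y → map (y ∷_) W) v∈′)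
        with _ , _ , eq ← ∈-map⁻ (y ∷_) v∈″ = All.lookup x∉M y∈M (List.∷-injectiveˡ eq)

InRange : ℕ → ℤ → Set
InRange n x = 1 ≤ ∣ x ∣ × ∣ x ∣ ≤ n

∈-signedValues⁻ : ∀ n {x} → x ∈ signedValues n → InRange n x
∈-signedValues⁻ n x∈ with ∈-++⁻ (map -[1+_] (upTo n)) x∈
... | inj₁ x∈⁻ with i , i∈ , refl ← ∈-map⁻ -[1+_] x∈⁻ = s≤s z≤n , ∈-upTo⁻ i∈
... | inj₂ x∈⁺ with i , i∈ , refl ← ∈-map⁻ (λ i → + suc i) x∈⁺ = s≤s z≤n , ∈-upTo⁻ i∈

∈-signedValues⁺ : ∀ n {x} → InRange n x → x ∈ signedValues n
∈-signedValues⁺ n {+ suc i}   (_ , i<n) =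
  ∈-++⁺ʳ (map -[1+_] (upTo n)) (∈-map⁺ (λ i → + suc i) (∈-upTo⁺ i<n))
∈-signedValues⁺ n { -[1+ i ]} (_ , i<n) = ∈-++⁺ˡ (∈-map⁺ -[1+_] (∈-upTo⁺ i<n))

signedValues-unique : ∀ n → Unique (signedValues n)
signedValues-unique n =
  Unique.++⁺ (Unique.map⁺ (λ { refl → refl }) (Unique.upTo⁺ n))
             (Unique.map⁺ (λ { refl → refl }) (Unique.upTo⁺ n)) disjoint
  where
  disjoint : ∀ {v} → ¬ (v ∈ map -[1+_] (upTo n) × v ∈ map (λ i → + suc i) (upTo n))
  disjoint (v∈⁻ , v∈⁺)
    with _ , _ , refl ← ∈-map⁻ -[1+_] v∈⁻
    with _ , _ , ()   ← ∈-map⁻ (λ i → + suc i) v∈⁺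

record IsSignedPermutation (n : ℕ) (w : List ℤ) : Set where
  field
    length≡   : length w ≡ n
    inRange   : All (InRange n) w
    absUnique : Unique (map ∣_∣ w)

∈B⇒isSignedPermutation : ∀ n {w} → w ∈ B n → IsSignedPermutation n w
∈B⇒isSignedPermutation n w∈
  with w∈words , noRep ← ∈-filter⁻ (λ w → T? (noRepeat (map ∣_∣ w))) {xs = words n (signedValues n)} w∈
  with len , w⊆ ← ∈-words⁻ n (signedValues n) w∈words
  = record { length≡ = len ; inRange = All.map (∈-signedValues⁻ n) w⊆ ; absUnique = noRepeat⇒Unique _ noRep }

isSignedPermutation⇒∈B : ∀ n {w} → IsSignedPermutation n w → w ∈ B n
isSignedPermutation⇒∈B n sp = ∈-filter⁺ (λ w → T? (noRepeat (map ∣_∣ w)))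
  (∈-words⁺ n (signedValues n) length≡ (All.map (∈-signedValues⁺ n) inRange))
  (Unique⇒noRepeat _ absUnique)
  where open IsSignedPermutation sp

B-unique : ∀ n → Unique (B n)
B-unique n = Unique.filter⁺ (λ w → T? (noRepeat (map ∣_∣ w))) (words-unique n (signedValues-unique n))

-- entry w i is w(i + 1), with the junk value + 0 outside the window.
entry : List ℤ → ℕ → ℤ
entry []      _       = + 0
entry (x ∷ w) zero    = x
entry (x ∷ w) (suc i) = entry w i

-- Counted from 0; length w if no entry has absolute value a.
position : ℕ → List ℤ → ℕ
position a []      = 0
position a (z ∷ w) = if ∣ z ∣ ≡ᵇ a then 0 else suc (position a w)

entry-∈ : ∀ w i → i < length w → entry w i ∈ w
entry-∈ (x ∷ w) zero    _         = here refl
entry-∈ (x ∷ w) (suc i) (s≤s i<n) = there (entry-∈ w i i<n)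

applyUpTo-entry : ∀ w → applyUpTo (entry w) (length w) ≡ w
applyUpTo-entry []      = refl
applyUpTo-entry (x ∷ w) = cong (x ∷_) (applyUpTo-entry w)

entry-applyUpTo : ∀ (f : ℕ → ℤ) n i → i < n → entry (applyUpTo f n) i ≡ f i
entry-applyUpTo f (suc n) zero    _         = refl
entry-applyUpTo f (suc n) (suc i) (s≤s i<n) = entry-applyUpTo (f ∘ suc) n i i<n

position-< : ∀ a w → a ∈ map ∣_∣ w → position a w < length w
position-< a (z ∷ w) a∈ with ∣ z ∣ ≡ᵇ a in z≟a | a∈
... | true  | _          = s≤s z≤n
... | false | here a≡z   = ⊥-elim (≡ᵇ≡false⇒≢ z≟a (sym a≡z))
... | false | there a∈w = s≤s (position-< a w a∈w)

∣entry-position∣ : ∀ a w → a ∈ map ∣_∣ w → ∣ entry w (position a w) ∣ ≡ a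
∣entry-position∣ a (z ∷ w) a∈ with ∣ z ∣ ≡ᵇ a in z≟a | a∈
... | true  | _          = ≡ᵇ≡true⇒≡ z≟a
... | false | here a≡z   = ⊥-elim (≡ᵇ≡false⇒≢ z≟a (sym a≡z))
... | false | there a∈w = ∣entry-position∣ a w a∈w

invAt-position : ∀ a w k → a ∈ map ∣_∣ w →
  invAt (suc k) w a ≡ sign (entry w (position a w)) ◃ (suc k + position a w)
invAt-position a (+ m ∷ w) k a∈ with m ≡ᵇ a in m≟a | a∈
... | true  | _          = cong (+_ ∘ suc) (sym (ℕ.+-identityʳ k))
... | false | here a≡m   = ⊥-elim (≡ᵇ≡false⇒≢ m≟a (sym a≡m))
... | false | there a∈w =
  trans (invAt-position a w (suc k) a∈w) (cong (sign (entry w (position a w)) ◃_) (sym (ℕ.+-suc (suc k) _)))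
invAt-position a (-[1+ m ] ∷ w) k a∈ with suc m ≡ᵇ a in m≟a | a∈
... | true  | _          = cong -[1+_] (sym (ℕ.+-identityʳ k))
... | false | here a≡m   = ⊥-elim (≡ᵇ≡false⇒≢ m≟a (sym a≡m))
... | false | there a∈w =
  trans (invAt-position a w (suc k) a∈w) (cong (sign (entry w (position a w)) ◃_) (sym (ℕ.+-suc (suc k) _)))

position-∣entry∣ : ∀ w i → Unique (map ∣_∣ w) → i < length w → position ∣ entry w i ∣ w ≡ i
position-∣entry∣ (x ∷ w) zero    _            _ rewrite dec-true (∣ x ∣ ℕ.≟ ∣ x ∣) refl = refl
position-∣entry∣ (x ∷ w) (suc i) (x∉w ∷ !w) (s≤s i<n)
  rewrite dec-false (∣ x ∣ ℕ.≟ ∣ entry w i ∣) (All.lookup x∉w (∈-map⁺ ∣_∣ (entry-∈ w i i<n))) =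
  cong suc (position-∣entry∣ w i !w i<n)

invF-applyUpTo : ∀ (f : ℕ → ℤ) n →
  invF (applyUpTo f n) ≡ ∑[ i < n ] ∑[ l < n ] ⟦ (i <ᵇ l) ∧ (f i >F f l) ⟧
invF-applyUpTo f zero    = refl
invF-applyUpTo f (suc n) = cong₂ _+_ (count-applyUpTo (f 0 >F_) (f ∘ suc) n) (invF-applyUpTo (f ∘ suc) n)

invF≡inversionCount : ∀ (f : ℕ → ℤ) n π →
  (∀ i l → i < n → l < n → i ≢ l → (f i >F f l) ≡ (π l <ᵇ π i)) →
  invF (applyUpTo f n) ≡ inversionCount n π
invF≡inversionCount f n π same =
  trans (invF-applyUpTo f n) (∑-cong n λ i i<n → ∑-cong n λ l l<n → cong ⟦_⟧ (pair i l i<n l<n))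
  where
  pair : ∀ i l → i < n → l < n → (i <ᵇ l) ∧ (f i >F f l) ≡ (i <ᵇ l) ∧ (π l <ᵇ π i)
  pair i l i<n l<n with i ℕ.≟ l
  ... | yes refl rewrite dec-false (i ℕ.<? i) (ℕ.<-irrefl refl) = refl
  ... | no  i≢l  = cong ((i <ᵇ l) ∧_) (same i l i<n l<n i≢l)

majFrom-applyUpTo-cong : ∀ n i (f g : ℕ → ℤ) →
  (∀ j → suc j < n → (f j >F f (suc j)) ≡ (g j >F g (suc j))) →
  majFrom i (applyUpTo f n) ≡ majFrom i (applyUpTo g n)
majFrom-applyUpTo-cong zero          i f g same = refl
majFrom-applyUpTo-cong (suc zero)    i f g same = refl
majFrom-applyUpTo-cong (suc (suc n)) i f g same =
  cong₂ _+_ (cong (if_then i else 0) (same 0 (s≤s (s≤s z≤n))))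
            (majFrom-applyUpTo-cong (suc n) (suc i) (f ∘ suc) (g ∘ suc) λ j j<n → same (suc j) (s≤s j<n))

∈-map-∣∣ : ∀ {n w} → IsSignedPermutation n w → ∀ {a} → 1 ≤ a → a ≤ n → a ∈ map ∣_∣ w
∈-map-∣∣ {n} {w} sp 1≤a a≤n = pigeonhole ℕ._≟_ absUnique ∣w∣⊆ ≤-len (∈-applyUpTo-suc 1≤a a≤n)
  where
  open IsSignedPermutation sp
  ∈-applyUpTo-suc : ∀ {m} → 1 ≤ m → m ≤ n → m ∈ applyUpTo suc n
  ∈-applyUpTo-suc {suc k} _ k<n = ∈-applyUpTo⁺ suc k<n
  ∣w∣⊆ : map ∣_∣ w ⊆ applyUpTo suc n
  ∣w∣⊆ z∈ with x , x∈w , refl ← ∈-map⁻ ∣_∣ z∈ = uncurry ∈-applyUpTo-suc (All.lookup inRange x∈w)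
  ≤-len : length (applyUpTo suc n) ≤ length (map ∣_∣ w)
  ≤-len = ℕ.≤-reflexive (trans (List.length-applyUpTo suc n) (sym (trans (List.length-map ∣_∣ w) length≡)))

-- The inverse of a signed permutation

isNeg-sign◃ : ∀ v m → isNeg (sign v ◃ suc m) ≡ isNeg v
isNeg-sign◃ (+ _)    m = refl
isNeg-sign◃ -[1+ _ ] m = refl

module SignedPermutation {n σ} (sp : IsSignedPermutation n σ) where

  open IsSignedPermutation sp

  -- In 0-based positions and values: posOf j = ∣ σ⁻¹(j + 1) ∣ - 1 and absAt i = ∣ σ(i + 1) ∣ - 1.
  posOf : ℕ → ℕ
  posOf j = position (suc j) σ

  absAt : ℕ → ℕ
  absAt i = pred ∣ entry σ i ∣

  inverseEntry : ℕ → ℤ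
  inverseEntry j = sign (entry σ (posOf j)) ◃ suc (posOf j)

  private
    suc-∈ : ∀ {j} → j < n → suc j ∈ map ∣_∣ σ
    suc-∈ j<n = ∈-map-∣∣ sp (s≤s z≤n) j<n

    <-length : ∀ {i} → i < n → i < length σ
    <-length {i} = subst (i <_) (sym length≡)

    inRange-entry : ∀ {i} → i < n → InRange n (entry σ i)
    inRange-entry i<n = All.lookup inRange (entry-∈ σ _ (<-length i<n))

  posOf-< : ∀ j → j < n → posOf j < n
  posOf-< j j<n = subst (posOf j <_) length≡ (position-< (suc j) σ (suc-∈ j<n))

  ∣entry∣≡suc-absAt : ∀ i → i < n → ∣ entry σ i ∣ ≡ suc (absAt i)
  ∣entry∣≡suc-absAt i i<n with ∣ entry σ i ∣ | inRange-entry i<n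
  ... | suc _ | _ = refl

  absAt-< : ∀ i → i < n → absAt i < n
  absAt-< i i<n = subst (_≤ n) (∣entry∣≡suc-absAt i i<n) (proj₂ (inRange-entry i<n))

  absAt-posOf : ∀ j → j < n → absAt (posOf j) ≡ j
  absAt-posOf j j<n = cong pred (∣entry-position∣ (suc j) σ (suc-∈ j<n))

  posOf-absAt : ∀ i → i < n → posOf (absAt i) ≡ i
  posOf-absAt i i<n = trans (cong (λ a → position a σ) (sym (∣entry∣≡suc-absAt i i<n)))
                            (position-∣entry∣ σ i absUnique (<-length i<n))

  posOf-injective : ∀ i j → i < n → j < n → posOf i ≡ posOf j → i ≡ j
  posOf-injective i j i<n j<n eq = trans (sym (absAt-posOf i i<n)) (trans (cong absAt eq) (absAt-posOf j j<n))

  ∣inverseEntry∣ : ∀ j → ∣ inverseEntry j ∣ ≡ suc (posOf j)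
  ∣inverseEntry∣ j = abs-◃ (sign (entry σ (posOf j))) (suc (posOf j))

  σ-applyUpTo : σ ≡ applyUpTo (entry σ) n
  σ-applyUpTo = trans (sym (applyUpTo-entry σ)) (cong (applyUpTo (entry σ)) length≡)

  inverse-applyUpTo : inverse σ ≡ applyUpTo inverseEntry n
  inverse-applyUpTo = trans (List.map-upTo _ (length σ)) (trans (cong (applyUpTo _) length≡)
    (applyUpTo-cong n λ j j<n → invAt-position (suc j) σ 0 (suc-∈ j<n)))

  entry-inverse : ∀ j → j < n → entry (inverse σ) j ≡ inverseEntry j
  entry-inverse j j<n = trans (cong (λ w → entry w j) inverse-applyUpTo) (entry-applyUpTo inverseEntry n j j<n)

  inverse-isSignedPermutation : IsSignedPermutation n (inverse σ)
  inverse-isSignedPermutation rewrite inverse-applyUpTo = record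
    { length≡   = List.length-applyUpTo inverseEntry n
    ; inRange   = All.applyUpTo⁺₁ inverseEntry n λ {j} j<n →
        subst (λ m → 1 ≤ m × m ≤ n) (sym (∣inverseEntry∣ j)) (s≤s z≤n , posOf-< j j<n)
    ; absUnique = subst Unique (sym (List.map-applyUpTo inverseEntry ∣_∣ n))
        (Unique.applyUpTo⁺₁ (∣_∣ ∘ inverseEntry) n λ {i} {j} i<j j<n ∣∣≡ →
          ℕ.<⇒≢ i<j (posOf-injective i j (ℕ.<-trans i<j j<n) j<n
            (ℕ.suc-injective (trans (sym (∣inverseEntry∣ i)) (trans ∣∣≡ (∣inverseEntry∣ j))))))
    }

  inverseEntry-compare : ∀ i l → i < n → l < n → i ≢ l →
    (inverseEntry i >F inverseEntry l) ≡ (posOf l <ᵇ posOf i)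
  inverseEntry-compare i l i<n l<n i≢l =
    trans (>F-abs (inverseEntry i) (inverseEntry l) (i≢l ∘ abs-injective))
          (cong₂ _<ᵇ_ (∣inverseEntry∣ l) (∣inverseEntry∣ i))
    where
    abs-injective : ∣ inverseEntry i ∣ ≡ ∣ inverseEntry l ∣ → i ≡ l
    abs-injective eq =
      posOf-injective i l i<n l<n (ℕ.suc-injective (trans (sym (∣inverseEntry∣ i)) (trans eq (∣inverseEntry∣ l))))

  entry-compare : ∀ i l → i < n → l < n → i ≢ l → (entry σ i >F entry σ l) ≡ (absAt l <ᵇ absAt i)
  entry-compare i l i<n l<n i≢l =
    trans (>F-abs (entry σ i) (entry σ l) (i≢l ∘ abs-injective))
          (cong₂ _<ᵇ_ (∣entry∣≡suc-absAt l l<n) (∣entry∣≡suc-absAt i i<n))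
    where
    abs-injective : ∣ entry σ i ∣ ≡ ∣ entry σ l ∣ → i ≡ l
    abs-injective eq = trans (sym (posOf-absAt i i<n)) (trans (cong (posOf ∘ pred) eq) (posOf-absAt l l<n))

  neg-inverse : neg (inverse σ) ≡ neg σ
  neg-inverse = begin
    neg (inverse σ)                           ≡⟨ cong neg inverse-applyUpTo ⟩
    count isNeg (applyUpTo inverseEntry n)    ≡⟨ count-applyUpTo isNeg inverseEntry n ⟩
    ∑[ j < n ] ⟦ isNeg (inverseEntry j) ⟧
      ≡⟨ ∑-cong n (λ j _ → cong ⟦_⟧ (isNeg-sign◃ (entry σ (posOf j)) (posOf j))) ⟩
    ∑[ j < n ] ⟦ isNeg (entry σ (posOf j)) ⟧
      ≡⟨ ∑-reindex n posOf posOf-< posOf-injective (λ i → ⟦ isNeg (entry σ i) ⟧) ⟩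
    ∑[ i < n ] ⟦ isNeg (entry σ i) ⟧          ≡⟨ count-applyUpTo isNeg (entry σ) n ⟨
    count isNeg (applyUpTo (entry σ) n)       ≡⟨ cong neg σ-applyUpTo ⟨
    neg σ                                     ∎
    where open ≡-Reasoning

  invF-inverse : invF (inverse σ) ≡ invF σ
  invF-inverse = begin
    invF (inverse σ)                    ≡⟨ cong invF inverse-applyUpTo ⟩
    invF (applyUpTo inverseEntry n)     ≡⟨ invF≡inversionCount inverseEntry n posOf inverseEntry-compare ⟩
    inversionCount n posOf              ≡⟨ inversionCount-inverse n posOf absAt absAt-< posOf-absAt ⟩
    inversionCount n absAt              ≡⟨ invF≡inversionCount (entry σ) n absAt entry-compare ⟨
    invF (applyUpTo (entry σ) n)        ≡⟨ cong invF σ-applyUpTo ⟨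
    invF σ                              ∎
    where open ≡-Reasoning

  finvF-inverse : finvF (inverse σ) ≡ finvF σ
  finvF-inverse = cong₂ (λ i k → 2 * i + k) invF-inverse neg-inverse

inverse-involutive : ∀ {n σ} → IsSignedPermutation n σ → inverse (inverse σ) ≡ σ
inverse-involutive {n} {σ} sp = begin
  inverse (inverse σ)        ≡⟨ T.inverse-applyUpTo ⟩
  applyUpTo T.inverseEntry n ≡⟨ applyUpTo-cong n inverseEntry-inverse ⟩
  applyUpTo (entry σ) n      ≡⟨ S.σ-applyUpTo ⟨
  σ                          ∎
  where
  open ≡-Reasoning
  module S = SignedPermutation sp
  module T = SignedPermutation S.inverse-isSignedPermutation

  inverseEntry-inverse : ∀ j → j < n → T.inverseEntry j ≡ entry σ j
  inverseEntry-inverse j j<n = begin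
    sign (entry (inverse σ) (T.posOf j)) ◃ suc (T.posOf j)
      ≡⟨ cong (λ i → sign (entry (inverse σ) i) ◃ suc i) T-posOf ⟩
    sign (entry (inverse σ) k) ◃ suc k
      ≡⟨ cong (λ v → sign v ◃ suc k) (S.entry-inverse k k<n) ⟩
    sign (S.inverseEntry k) ◃ suc k
      ≡⟨ cong (λ i → sign (sign (entry σ i) ◃ suc i) ◃ suc k) (S.posOf-absAt j j<n) ⟩
    sign (sign (entry σ j) ◃ suc j) ◃ suc k
      ≡⟨ cong (_◃ suc k) (sign-◃ (sign (entry σ j)) (suc j)) ⟩
    sign (entry σ j) ◃ suc k
      ≡⟨ cong (sign (entry σ j) ◃_) (S.∣entry∣≡suc-absAt j j<n) ⟨
    sign (entry σ j) ◃ ∣ entry σ j ∣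
      ≡⟨ ◃-inverse (entry σ j) ⟩
    entry σ j ∎
    where
    k = S.absAt j
    k<n = S.absAt-< j j<n
    T-absAt : T.absAt k ≡ j
    T-absAt =
      trans (cong (pred ∘ ∣_∣) (S.entry-inverse k k<n)) (trans (cong pred (S.∣inverseEntry∣ k)) (S.posOf-absAt j j<n))
    T-posOf : T.posOf j ≡ k
    T-posOf = trans (cong T.posOf (sym T-absAt)) (T.posOf-absAt k k<n)

-- Foata's bijection on B_n

hasAbs : ℕ → ℕ → ℤ → Bool
hasAbs a b z = (∣ z ∣ ≡ᵇ a) ∨ (∣ z ∣ ≡ᵇ b)

position-order-filter : ∀ a b w → (position b w <ᵇ position a w) ≡
  (position b (filterᵇ (hasAbs a b) w) <ᵇ position a (filterᵇ (hasAbs a b) w))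
position-order-filter a b []      = refl
position-order-filter a b (z ∷ w) with ∣ z ∣ ≡ᵇ a in z≟a | ∣ z ∣ ≡ᵇ b in z≟b
... | true  | _     rewrite z≟a       = refl
... | false | true  rewrite z≟a | z≟b = refl
... | false | false = position-order-filter a b w

hasAbs-bounds : ∀ a y → hasAbs a (suc a) y ≡ true → a ≤ ∣ y ∣ × ∣ y ∣ ≤ suc a
hasAbs-bounds a y q with ∣ y ∣ ≡ᵇ a in ∣y∣≟a
... | true  = ℕ.≤-reflexive (sym ∣y∣≡a) , subst (_≤ suc a) (sym ∣y∣≡a) (ℕ.n≤1+n a)
  where ∣y∣≡a = ≡ᵇ≡true⇒≡ {∣ y ∣} {a} ∣y∣≟a
... | false = subst (a ≤_) (sym ∣y∣≡1+a) (ℕ.n≤1+n a) , ℕ.≤-reflexive ∣y∣≡1+a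
  where ∣y∣≡1+a = ≡ᵇ≡true⇒≡ {∣ y ∣} {suc a} q

between-hasAbs : ∀ a x y z → hasAbs a (suc a) y ≡ true → hasAbs a (suc a) z ≡ true →
  key y < key x → key x < key z → ∣ x ∣ ≡ ∣ y ∣ ⊎ ∣ x ∣ ≡ ∣ z ∣
between-hasAbs a x y z qy qz ky<kx kx<kz with ℕ.m≤n⇒m<n∨m≡n (key<⇒∣∣≤ y x ky<kx)
... | inj₂ ∣y∣≡∣x∣ = inj₁ (sym ∣y∣≡∣x∣)
... | inj₁ ∣y∣<∣x∣ = inj₂ (ℕ.≤-antisym (key<⇒∣∣≤ x z kx<kz) (begin
  ∣ z ∣     ≤⟨ proj₂ (hasAbs-bounds a z qz) ⟩
  suc a     ≤⟨ s≤s (proj₁ (hasAbs-bounds a y qy)) ⟩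
  suc ∣ y ∣ ≤⟨ ∣y∣<∣x∣ ⟩
  ∣ x ∣     ∎))
  where open ℕ.≤-Reasoning

consecutive-hasAbs : ∀ a w → Unique (map ∣_∣ w) → F.Consecutive (hasAbs a (suc a)) w
consecutive-hasAbs a w !∣w∣ {x} {y} {z} x∈ y∈ z∈ qy qz z>x x>y
  with between-hasAbs a x y z qy qz (<ᵇ≡true⇒< x>y) (<ᵇ≡true⇒< z>x)
... | inj₁ ∣x∣≡∣y∣ with refl ← unique-map⇒injectiveOn ∣_∣ !∣w∣ x∈ y∈ ∣x∣≡∣y∣ =
  not-¬ x>y (>F-irrefl x)
... | inj₂ ∣x∣≡∣z∣ with refl ← unique-map⇒injectiveOn ∣_∣ !∣w∣ x∈ z∈ ∣x∣≡∣z∣ =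
  not-¬ z>x (>F-irrefl x)

module FoataOnSignedPermutations {n σ} (sp : IsSignedPermutation n σ) where

  open IsSignedPermutation sp
  module S = SignedPermutation sp

  private
    !σ : Unique σ
    !σ = Unique.map⁻ absUnique

  foata-isSignedPermutation : IsSignedPermutation n (F.foata σ)
  foata-isSignedPermutation = record
    { length≡   = trans (↭-length (F.foata-↭ σ)) length≡
    ; inRange   = All-resp-↭ (↭-sym (F.foata-↭ σ)) inRange
    ; absUnique = unique-↭ (map⁺ ∣_∣ (↭-sym (F.foata-↭ σ))) absUnique
    }

  module Φ = SignedPermutation foata-isSignedPermutation

  neg-foata : neg (F.foata σ) ≡ neg σ
  neg-foata = count-↭ isNeg (F.foata-↭ σ)

  foata-position-order : ∀ a →
    (position (suc a) (F.foata σ) <ᵇ position a (F.foata σ)) ≡ (position (suc a) σ <ᵇ position a σ)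
  foata-position-order a = begin
    position (suc a) (F.foata σ) <ᵇ position a (F.foata σ)
      ≡⟨ position-order-filter a (suc a) (F.foata σ) ⟩
    position (suc a) (filterᵇ q (F.foata σ)) <ᵇ position a (filterᵇ q (F.foata σ))
      ≡⟨ cong (λ w → position (suc a) w <ᵇ position a w)
           (F.foata-filter q σ !σ (consecutive-hasAbs a σ absUnique)) ⟩
    position (suc a) (filterᵇ q σ) <ᵇ position a (filterᵇ q σ)
      ≡⟨ position-order-filter a (suc a) σ ⟨
    position (suc a) σ <ᵇ position a σ ∎
    where
    open ≡-Reasoning
    q = hasAbs a (suc a)

  flagMajF≡finvF-foata : flagMajF σ ≡ finvF (F.foata σ)
  flagMajF≡finvF-foata = cong₂ (λ m k → 2 * m + k) majF≡invF (sym neg-foata)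
    where
    majF≡invF : majF σ ≡ invF (F.foata σ)
    majF≡invF = trans (majFrom≡majorIndexFrom 1 σ)
      (trans (sym (F.foata-inversions σ !σ)) (sym (invF≡inversions (F.foata σ))))

  flagMajF-inverse-foata : flagMajF (inverse (F.foata σ)) ≡ flagMajF (inverse σ)
  flagMajF-inverse-foata =
    cong₂ (λ m k → 2 * m + k) majF-inverse (trans Φ.neg-inverse (trans neg-foata (sym S.neg-inverse)))
    where
    descents : ∀ j → suc j < n →
      (Φ.inverseEntry j >F Φ.inverseEntry (suc j)) ≡ (S.inverseEntry j >F S.inverseEntry (suc j))
    descents j j+1<n = trans (Φ.inverseEntry-compare j (suc j) j<n j+1<n j≢j+1)
      (trans (foata-position-order (suc j)) (sym (S.inverseEntry-compare j (suc j) j<n j+1<n j≢j+1)))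
      where
      j<n = ℕ.<-trans (ℕ.n<1+n j) j+1<n
      j≢j+1 = ℕ.<⇒≢ (ℕ.n<1+n j)
    majF-inverse : majF (inverse (F.foata σ)) ≡ majF (inverse σ)
    majF-inverse = trans (cong majF Φ.inverse-applyUpTo)
      (trans (majFrom-applyUpTo-cong n 1 Φ.inverseEntry S.inverseEntry descents) (sym (cong majF S.inverse-applyUpTo)))

inverse-∈B : ∀ n {σ} → σ ∈ B n → inverse σ ∈ B n
inverse-∈B n =
  isSignedPermutation⇒∈B n ∘ SignedPermutation.inverse-isSignedPermutation ∘ ∈B⇒isSignedPermutation n

foata-∈B : ∀ n {σ} → σ ∈ B n → F.foata σ ∈ B n
foata-∈B n =
  isSignedPermutation⇒∈B n ∘ FoataOnSignedPermutations.foata-isSignedPermutation ∘ ∈B⇒isSignedPermutation n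

inverse-injectiveOnB : ∀ n → InjectiveOn inverse (B n)
inverse-injectiveOnB n σ∈ τ∈ eq = trans (sym (involutive σ∈)) (trans (cong inverse eq) (involutive τ∈))
  where
  involutive : ∀ {σ} → σ ∈ B n → inverse (inverse σ) ≡ σ
  involutive = inverse-involutive ∘ ∈B⇒isSignedPermutation n

foata-injectiveOnB : ∀ n → InjectiveOn F.foata (B n)
foata-injectiveOnB n σ∈ τ∈ = F.foata-injective _ _ (unique σ∈) (unique τ∈)
  where
  unique : ∀ {σ} → σ ∈ B n → Unique σ
  unique = Unique.map⁻ ∘ IsSignedPermutation.absUnique ∘ ∈B⇒isSignedPermutation n

coeff-cong : ∀ n {f f′ g g′ : List ℤ → ℕ} →
  (∀ {σ} → σ ∈ B n → f σ ≡ f′ σ) → (∀ {σ} → σ ∈ B n → g σ ≡ g′ σ) →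
  ∀ a b → coeff n f g a b ≡ coeff n f′ g′ a b
coeff-cong n f≗f′ g≗g′ a b =
  count-cong (B n) λ σ∈ → cong₂ (λ u v → (u ≡ᵇ a) ∧ (v ≡ᵇ b)) (f≗f′ σ∈) (g≗g′ σ∈)

coeff-congˡ : ∀ n {f f′ : List ℤ → ℕ} g → (∀ {σ} → σ ∈ B n → f σ ≡ f′ σ) →
  ∀ a b → coeff n f g a b ≡ coeff n f′ g a b
coeff-congˡ n g f≗f′ = coeff-cong n f≗f′ λ {σ} _ → refl {x = g σ}

coeff-∘ : ∀ n (h : List ℤ → List ℤ) → (∀ {σ} → σ ∈ B n → h σ ∈ B n) → InjectiveOn h (B n) →
  ∀ f g a b → coeff n (f ∘ h) (g ∘ h) a b ≡ coeff n f g a b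
coeff-∘ n h h-into h-inj f g a b =
  count-reindex (List.≡-dec ℤ._≟_) (λ σ → (f σ ≡ᵇ a) ∧ (g σ ≡ᵇ b)) h (B-unique n) h-into h-inj

mainTheorem12 : (n : ℕ) → 1 ≤ n → (a b : ℕ) →
    coeff n (λ σ → flagMajF (inverse σ)) flagMajF a b ≡ coeff n finvF flagMajF a b
mainTheorem12 n _ a b = begin
  coeff n (flagMajF ∘ inverse) flagMajF a b
    ≡⟨ coeff-∘ n inverse (inverse-∈B n) (inverse-injectiveOnB n) (flagMajF ∘ inverse) flagMajF a b ⟨
  coeff n (flagMajF ∘ inverse ∘ inverse) (flagMajF ∘ inverse) a b
    ≡⟨ coeff-congˡ n (flagMajF ∘ inverse) (cong flagMajF ∘ inverse-involutive ∘ sp) a b ⟩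
  coeff n flagMajF (flagMajF ∘ inverse) a b
    ≡⟨ coeff-cong n Foataσ.flagMajF≡finvF-foata (sym ∘ Foataσ.flagMajF-inverse-foata) a b ⟩
  coeff n (finvF ∘ F.foata) (flagMajF ∘ inverse ∘ F.foata) a b
    ≡⟨ coeff-∘ n F.foata (foata-∈B n) (foata-injectiveOnB n) finvF (flagMajF ∘ inverse) a b ⟩
  coeff n finvF (flagMajF ∘ inverse) a b
    ≡⟨ coeff-congˡ n (flagMajF ∘ inverse) (sym ∘ SignedPermutation.finvF-inverse ∘ sp) a b ⟩
  coeff n (finvF ∘ inverse) (flagMajF ∘ inverse) a b
    ≡⟨ coeff-∘ n inverse (inverse-∈B n) (inverse-injectiveOnB n) finvF flagMajF a b ⟩
  coeff n finvF flagMajF a b ∎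
  where
  open ≡-Reasoning
  sp : ∀ {σ} → σ ∈ B n → IsSignedPermutation n σ
  sp = ∈B⇒isSignedPermutation n
  module Foataσ {σ} (σ∈ : σ ∈ B n) = FoataOnSignedPermutations (sp σ∈)
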